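{- Let $T=(\Sigma,E)$ be a graded nominal theory, let $n\le\omega$, and let $X$ be a nominal set. Let $FX$ be the $(\Sigma,n)$-algebra with carriers $(FX)_i=\mathsf{Term}_{\Sigma,i}(X)/{\sim}$ (for $i\le n$, resp. $i<\omega$ if $n=\omega$), where $\sim$ is derivable equality in $T$ (i.e. $t\sim u$ iff $X\vdash_i t=u$ is derivable, with class $[t]_i$), and operations $f_{FX,m}([t_1]_m,\dots,[t_p]_m)=[f(t_1,\dots,t_p)]_{m+d(f)}$ for $f\in\Sigma_0$, $f_{FX,m}(a,[t_1]_m,\dots,[t_p]_m)=[a.f(t_1,\dots,t_p)]_{m+d(f)}$ for $f\in\Sigma_{\mathsf f}$, $f_{FX,m}(\langle a\rangle([t_1]_m,\dots,[t_p]_m))=[\nu a.f(t_1,\dots,t_p)]_{m+d(f)}$ for $f\in\Sigma_{\mathsf b}$, and let $\eta\colon X\to(FX)_0$, $\eta(x)=[x]_0$. Then $FX$ is a $(T,n)$-model, and it is free over $X$ with universal arrow $\eta$: for every $(T,n)$-model $A$ and every equivariant map $g\colon X\to A_0$ there is a unique homomorphism $h\colon FX\to A$ of $(\Sigma,n)$-algebras with $h_0\circ\eta=g$.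
   Context: Nominal sets: fix a countably infinite set $\mathbb{A}$ of names and let $G$ be the group of finite permutations of $\mathbb{A}$; $(a\,b)$ is the transposition of $a,b$. A nominal set is a set $X$ with a left $G$-action such that every $x$ has a finite support (a finite $S\subseteq\mathbb{A}$ such that $\pi\cdot x=x$ for every $\pi$ fixing $S$ pointwise); $\mathsf{supp}(x)$ is the least support, $a\# x$ means $a\notin\mathsf{supp}(x)$. Equivariant maps satisfy $f(\pi\cdot x)=\pi\cdot f(x)$. Orbit-finite = finitely many orbits. $\mathbb{A}$ is nominal via $\pi\cdot a=\pi(a)$; products carry the componentwise action. $[\mathbb{A}]X$ is the quotient of $\mathbb{A}\times X$ by $(a,x)\sim(b,y)$ iff $(c\,a)\cdot x=(c\,b)\cdot y$ for some $c$ fresh for $a,b,x,y$; classes are written $\langle a\rangle x$ and $\pi\cdot\langle a\rangle x=\langle\pi(a)\rangle(\pi\cdot x)$. Signatures and terms: a nominal graded signature $\Sigma$ is a disjoint union of sets $\Sigma_0$ (pure), $\Sigma_{\mathsf f}$ (free), $\Sigma_{\mathsf b}$ (bound) of operations, each with an arity $\mathsf{ar}(f)\in\mathbb{N}$ and a depth $d(f)\in\mathbb{N}$. Terms over a nominal set $X$: $t::=x\mid f(t_1,..,t_p)\mid a.g(t_1,..,t_p)\mid\nu a.h(t_1,..,t_p)$ ($x\in X$, $a\in\mathbb{A}$, $f\in\Sigma_0,g\in\Sigma_{\mathsf f},h\in\Sigma_{\mathsf b}$ of arity $p$); write $\eta.f(\vec t)$ generically with prefix $\eta$ empty, $a$ or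 $\nu a$. Variables have uniform depth $0$; $\eta.f(t_1,..,t_p)$ has uniform depth $m+d(f)$ if all $t_i$ have uniform depth $m$. $\mathsf{Term}_{\Sigma,m}(X)$ is the set of terms of uniform depth $m$, a nominal set under $\pi\cdot f(\vec t)=f(\pi\cdot\vec t)$, $\pi\cdot a.g(\vec t)=\pi(a).g(\pi\cdot\vec t)$, $\pi\cdot\nu a.h(\vec t)=\nu\pi(a).h(\pi\cdot\vec t)$. A substitution $\sigma\colon Y\to\mathsf{Term}_{\Sigma,l}(X)$ acts by $t\mapsto t\sigma$, replacing variables without renaming bound names. Theories and derivations: a depth-$n$ equation $X\vdash_n t=u$ has $X$ orbit-finite and $t,u\in\mathsf{Term}_{\Sigma,n}(X)$; a graded theory is $T=(\Sigma,E)$ with $E$ a set of equations (axioms). Derivable judgements $X\vdash_m t=u$ ($X$ any nominal set) are the least set closed under: (refl) $X\vdash_0x=x$; (symm); (trans); (cong) from $X\vdash_m t_i=u_i$ for all $i$ infer $X\vdash_{m+d(f)}\eta.f(\vec t)=\eta.f(\vec u)$; (ax) for an axiom $Y\vdash_m r=s$, $\tau\in G$ and $\sigma\colon Y\to\mathsf{Term}_{\Sigma,l}(X)$ with $X\vdash_l\pi\cdot\sigma(y)=\sigma(\pi\cdot y)$ derivable for all $\pi\in G,y\in Y$, infer $X\vdash_{m+l}(\tau\cdot r)\sigma=(\tau\cdot s)\sigma$; (perm) for $h\in\Sigma_{\mathsf b}$, names $a\neq b$ with $a\# u_i$ for all $i$, from $X\vdash_m t_i=(a\,b)\cdot u_i$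 for all $i$ infer $X\vdash_{m+d(h)}\nu a.h(\vec t)=\nu b.h(\vec u)$. Algebras: for $n\le\omega$, a $(\Sigma,n)$-algebra $A$ has nominal sets $A_i$ ($0\le i\le n$; $i<\omega$ if $n=\omega$) and for $f\in\Sigma$ of arity $p$ and $m+d(f)\le n$ equivariant maps $f_{A,m}$ of type $A_m^p\to A_{m+d(f)}$ ($\Sigma_0$), $\mathbb{A}\times A_m^p\to A_{m+d(f)}$ ($\Sigma_{\mathsf f}$), $[\mathbb{A}](A_m^p)\to A_{m+d(f)}$ ($\Sigma_{\mathsf b}$). A homomorphism $h\colon A\to B$ is a family of equivariant maps $h_i\colon A_i\to B_i$ with $h_{m+d(f)}(f_{A,m}(\vec x))=f_{B,m}(h_m(\vec x))$, $h_{m+d(f)}(f_{A,m}(a,\vec x))=f_{B,m}(a,h_m(\vec x))$, $h_{m+d(f)}(f_{A,m}(\langle a\rangle\vec x))=f_{B,m}(\langle a\rangle h_m(\vec x))$ in the three cases. For an equivariant valuation $\iota\colon X\to A_k$ and $t\in\mathsf{Term}_{\Sigma,m}(X)$, $k+m\le n$, the value $[\![t]\!]^\iota_m\in A_{k+m}$ is: $[\![x]\!]^\iota_0=\iota(x)$, $[\![f(\vec t)]\!]^\iota_{m+d(f)}=f_{A,k+m}([\![\vec t]\!]^\iota_m)$, $[\![a.f(\vec t)]\!]^\iota_{m+d(f)}=f_{A,k+m}(a,[\![\vec t]\!]^\iota_m)$, $[\![\nu a.f(\vec t)]\!]^\iota_{m+d(f)}=f_{A,k+m}(\langle a\rangle[\![\vec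 t]\!]^\iota_m)$. $A$ satisfies $X\vdash_m t=u$ if $[\![t]\!]^\iota_m=[\![u]\!]^\iota_m$ for all $k$ with $k+m\le n$ and all equivariant $\iota\colon X\to A_k$. A $(T,n)$-model is a $(\Sigma,n)$-algebra satisfying all axioms in $E$. -}

module Defs where

open import Level using () renaming (zero to lzero)
open import Data.Nat using (ℕ; zero; suc; _+_; _≤_; z≤n; _≟_)
open import Data.Nat.Properties using (≤-trans; m≤m+n; +-assoc; +-identityʳ)
open import Data.Unit using (⊤; tt)
open import Data.Empty using (⊥)
open import Data.Product using (Σ; _×_; _,_; proj₁; proj₂)
open import Data.List using (List; []; _∷_; _++_)
open import Data.List.Membership.Propositional using (_∈_; _∉_)
open import Data.List.Membership.Propositional.Properties using (∈-++⁺ˡ; ∈-++⁺ʳ)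
open import Data.List.Relation.Unary.Any using (here; there)
open import Data.Vec using (Vec; []; _∷_; map)
open import Data.Vec.Relation.Unary.All using (All; []; _∷_)
open import Data.Vec.Relation.Binary.Pointwise.Inductive using (Pointwise; []; _∷_)
open import Relation.Nullary using (¬_; yes; no)
open import Relation.Binary using (IsEquivalence)
open import Relation.Binary.PropositionalEquality using (_≡_; refl; sym; trans; cong; subst)
open import Function using (_∘_; id)

𝔸 : Set
𝔸 = ℕ

record Perm : Set where
  field
    fun   : 𝔸 → 𝔸
    inv   : 𝔸 → 𝔸
    left  : ∀ a → inv (fun a) ≡ a
    right : ∀ a → fun (inv a) ≡ a
    dom   : List 𝔸
    finite : ∀ a → a ∉ dom → fun a ≡ a
open Perm public

idP : Perm
idP = record { fun = id ; inv = id ; left = λ _ → refl ; right = λ _ → refl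
             ; dom = [] ; finite = λ _ _ → refl }

_∘P_ : Perm → Perm → Perm
π ∘P ρ = record
  { fun = fun π ∘ fun ρ
  ; inv = inv ρ ∘ inv π
  ; left = λ a → trans (cong (inv ρ) (left π (fun ρ a))) (left ρ a)
  ; right = λ a → trans (cong (fun π) (right ρ (inv π a))) (right π a)
  ; dom = dom π ++ dom ρ
  ; finite = λ a a∉ → trans (cong (fun π) (finite ρ a (λ a∈ → a∉ (∈-++⁺ʳ (dom π) a∈))))
                          (finite π a (λ a∈ → a∉ (∈-++⁺ˡ a∈)))
  }

swapF : 𝔸 → 𝔸 → 𝔸 → 𝔸
swapF a b c with c ≟ a
... | yes _ = b
... | no _ with c ≟ b
...   | yes _ = a
...   | no _ = c

private
  swapF-invol : ∀ a b c → swapF a b (swapF a b c) ≡ c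
  swapF-invol a b c with c ≟ a
  swapF-invol a b c | yes c≡a with b ≟ a
  ... | yes b≡a = trans b≡a (sym c≡a)
  ... | no _ with b ≟ b
  ...   | yes _ = sym c≡a
  ...   | no b≢b = Data.Empty.⊥-elim (b≢b refl)
    where import Data.Empty
  swapF-invol a b c | no c≢a with c ≟ b
  swapF-invol a b c | no c≢a | yes c≡b with a ≟ a
  ... | yes _ = sym c≡b
  ... | no a≢a = Data.Empty.⊥-elim (a≢a refl)
    where import Data.Empty
  swapF-invol a b c | no c≢a | no c≢b with c ≟ a
  ... | yes c≡a = Data.Empty.⊥-elim (c≢a c≡a)
    where import Data.Empty
  ... | no _ with c ≟ b
  ...   | yes c≡b = Data.Empty.⊥-elim (c≢b c≡b)
    where import Data.Empty
  ...   | no _ = refl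

  swapF-fin : ∀ a b c → c ∉ (a ∷ b ∷ []) → swapF a b c ≡ c
  swapF-fin a b c c∉ with c ≟ a
  ... | yes c≡a = Data.Empty.⊥-elim (c∉ (here c≡a))
    where import Data.Empty
  ... | no _ with c ≟ b
  ...   | yes c≡b = Data.Empty.⊥-elim (c∉ (there (here c≡b)))
    where import Data.Empty
  ...   | no _ = refl

swap : 𝔸 → 𝔸 → Perm
swap a b = record
  { fun = swapF a b ; inv = swapF a b
  ; left = swapF-invol a b ; right = swapF-invol a b
  ; dom = a ∷ b ∷ [] ; finite = swapF-fin a b }

Fixes : Perm → List 𝔸 → Set
Fixes π S = ∀ a → a ∈ S → fun π a ≡ a

Supports : {C : Set} → (C → C → Set) → (Perm → C → C) → List 𝔸 → C → Set
Supports R act S x = ∀ π → Fixes π S → R (act π x) x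

-- a # x : a lies outside some finite support of x (equivalently, outside
-- the least support)
Fresh : {C : Set} → (C → C → Set) → (Perm → C → C) → 𝔸 → C → Set
Fresh R act a x = Σ (List 𝔸) λ S → (a ∉ S) × Supports R act S x

record NomType : Set₁ where
  field
    Car    : Set
    act    : Perm → Car → Car
    act-id : ∀ x → act idP x ≡ x
    act-∘  : ∀ π ρ x → act (π ∘P ρ) x ≡ act π (act ρ x)
    act-ext : ∀ π ρ → (∀ a → fun π a ≡ fun ρ a) → ∀ x → act π x ≡ act ρ x
    finSupp : ∀ x → Σ (List 𝔸) λ S → Supports _≡_ act S x

-- A nominal set presented as a setoid (to allow quotients).
record IsNomSetoid (Car : Set) (_≈_ : Car → Car → Set) (act : Perm → Car → Car) : Set where
  field
    isEquivalence : IsEquivalence _≈_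
    act-cong : ∀ π {x y} → x ≈ y → act π x ≈ act π y
    act-id   : ∀ x → act idP x ≈ x
    act-∘    : ∀ π ρ x → act (π ∘P ρ) x ≈ act π (act ρ x)
    act-ext  : ∀ π ρ → (∀ a → fun π a ≡ fun ρ a) → ∀ x → act π x ≈ act ρ x
    finSupp  : ∀ x → Σ (List 𝔸) λ S → Supports _≈_ act S x

record NomSetoid : Set₁ where
  field
    Car : Set
    _≈_ : Car → Car → Set
    act : Perm → Car → Car
    isNomSetoid : IsNomSetoid Car _≈_ act

OrbitFinite : NomType → Set
OrbitFinite Y = Σ (List (NomType.Car Y)) λ reps →
  ∀ y → Σ (NomType.Car Y) λ r → (r ∈ reps) × Σ Perm λ π → NomType.act Y π r ≡ y

actV : {C : Set} {p : ℕ} → (Perm → C → C) → Perm → Vec C p → Vec C p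
actV act π = map (act π)

FreshV : {C : Set} {p : ℕ} → (C → C → Set) → (Perm → C → C) → 𝔸 → Vec C p → Set
FreshV R act a xs = Fresh (Pointwise R) (actV act) a xs

-- ⟨a⟩xs = ⟨b⟩ys in [𝔸](A^p)
AlphaEq : (A : NomSetoid) {p : ℕ} → 𝔸 → Vec (NomSetoid.Car A) p → 𝔸 → Vec (NomSetoid.Car A) p → Set
AlphaEq A a xs b ys = Σ 𝔸 λ c →
  (¬ c ≡ a) × (¬ c ≡ b) × FreshV _≈_ act c xs × FreshV _≈_ act c ys ×
  Pointwise _≈_ (actV act (swap c a) xs) (actV act (swap c b) ys)
  where open NomSetoid A

data ℕ∞ : Set where
  fin : ℕ → ℕ∞
  ω   : ℕ∞

infix 4 _≤̂_
_≤̂_ : ℕ → ℕ∞ → Set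
i ≤̂ fin N = i ≤ N
i ≤̂ ω = ⊤

≤̂-mono : ∀ {i j} n → i ≤ j → j ≤̂ n → i ≤̂ n
≤̂-mono (fin N) i≤j j≤N = ≤-trans i≤j j≤N
≤̂-mono ω _ _ = tt

≤̂-weaken : ∀ {i} j n → i + j ≤̂ n → i ≤̂ n
≤̂-weaken {i} j n = ≤̂-mono n (m≤m+n i j)

0≤̂ : ∀ n → 0 ≤̂ n
0≤̂ (fin N) = z≤n
0≤̂ ω = tt

record Signature : Set₁ where
  field
    Op₀ Opf Opb : Set
    ar₀ : Op₀ → ℕ
    arf : Opf → ℕ
    arb : Opb → ℕ
    d₀  : Op₀ → ℕ
    df  : Opf → ℕ
    db  : Opb → ℕ

module _ (Sg : Signature) where
  open Signature Sg

  data Term (V : Set) : Set where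
    var   : V → Term V
    pure  : (f : Op₀) → Vec (Term V) (ar₀ f) → Term V
    free  : (g : Opf) → 𝔸 → Vec (Term V) (arf g) → Term V
    bound : (h : Opb) → 𝔸 → Vec (Term V) (arb h) → Term V

  data UD {V : Set} : ℕ → Term V → Set where
    var   : ∀ x → UD 0 (var x)
    pure  : ∀ {m} f {ts} → All (UD m) ts → UD (m + d₀ f) (pure f ts)
    free  : ∀ {m} g a {ts} → All (UD m) ts → UD (m + df g) (free g a ts)
    bound : ∀ {m} h a {ts} → All (UD m) ts → UD (m + db h) (bound h a ts)

  mutual
    actT : {V : Set} → (Perm → V → V) → Perm → Term V → Term V
    actT act π (var x) = var (act π x)
    actT act π (pure f ts) = pure f (actTs act π ts)
    actT act π (free g a ts) = free g (fun π a) (actTs act π ts)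
    actT act π (bound h a ts) = bound h (fun π a) (actTs act π ts)

    actTs : {V : Set} {p : ℕ} → (Perm → V → V) → Perm → Vec (Term V) p → Vec (Term V) p
    actTs act π [] = []
    actTs act π (t ∷ ts) = actT act π t ∷ actTs act π ts

  -- substitution (no renaming of bound names)
  mutual
    substT : {V W : Set} → (V → Term W) → Term V → Term W
    substT σ (var x) = σ x
    substT σ (pure f ts) = pure f (substTs σ ts)
    substT σ (free g a ts) = free g a (substTs σ ts)
    substT σ (bound h a ts) = bound h a (substTs σ ts)

    substTs : {V W : Set} {p : ℕ} → (V → Term W) → Vec (Term V) p → Vec (Term W) p
    substTs σ [] = []
    substTs σ (t ∷ ts) = substT σ t ∷ substTs σ ts

  mutual
    actT-UD : {V : Set} (act : Perm → V → V) (π : Perm) {m : ℕ} {t : Term V} →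
              UD m t → UD m (actT act π t)
    actT-UD act π (var x) = var (act π x)
    actT-UD act π (pure f ps) = pure f (actTs-UD act π ps)
    actT-UD act π (free g a ps) = free g (fun π a) (actTs-UD act π ps)
    actT-UD act π (bound h a ps) = bound h (fun π a) (actTs-UD act π ps)

    actTs-UD : {V : Set} (act : Perm → V → V) (π : Perm) {m p : ℕ} {ts : Vec (Term V) p} →
               All (UD m) ts → All (UD m) (actTs act π ts)
    actTs-UD act π [] = []
    actTs-UD act π (q ∷ qs) = actT-UD act π q ∷ actTs-UD act π qs

record Theory : Set₁ where
  field
    sig   : Signature
    Ax    : Set                          -- index set of the axioms E
    ctx   : Ax → NomType
    ctx-orbitFinite : ∀ e → OrbitFinite (ctx e)
    depth : Ax → ℕ
    lhs rhs : (e : Ax) → Term sig (NomType.Car (ctx e))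
    lhs-UD : ∀ e → UD sig (depth e) (lhs e)
    rhs-UD : ∀ e → UD sig (depth e) (rhs e)

module _ (T : Theory) (X : NomType) where
  open Theory T
  open Signature sig
  private
    TX = Term sig (NomType.Car X)
    actX = NomType.act X

  FreshT : 𝔸 → TX → Set
  FreshT = Fresh _≡_ (actT sig actX)

  data Deriv : ℕ → TX → TX → Set where
    refl′ : ∀ x → Deriv 0 (var x) (var x)
    symm  : ∀ {m t u} → Deriv m t u → Deriv m u t
    trans′ : ∀ {m t u v} → Deriv m t u → Deriv m u v → Deriv m t v
    cong₀ : ∀ {m} f {ts us} → Pointwise (Deriv m) ts us →
            Deriv (m + d₀ f) (pure f ts) (pure f us)
    congf : ∀ {m} g a {ts us} → Pointwise (Deriv m) ts us →
            Deriv (m + df g) (free g a ts) (free g a us)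
    congb : ∀ {m} h a {ts us} → Pointwise (Deriv m) ts us →
            Deriv (m + db h) (bound h a ts) (bound h a us)
    ax    : ∀ e (τ : Perm) {l} (σ : NomType.Car (ctx e) → TX) →
            (∀ y → UD sig l (σ y)) →
            (∀ π y → Deriv l (actT sig actX π (σ y)) (σ (NomType.act (ctx e) π y))) →
            Deriv (depth e + l)
                  (substT sig σ (actT sig (NomType.act (ctx e)) τ (lhs e)))
                  (substT sig σ (actT sig (NomType.act (ctx e)) τ (rhs e)))
    perm  : ∀ {m} h a b {ts us} → ¬ a ≡ b → All (FreshT a) us →
            Pointwise (λ t u → Deriv m t (actT sig actX (swap a b) u)) ts us →
            Deriv (m + db h) (bound h a ts) (bound h b us)

-- Carriers are given for every level i : ℕ, but only
-- those with i ≤̂ n are used (operations, homomorphisms, satisfaction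
-- only refer to levels ≤̂ n); the others are irrelevant padding.

record Algebra (Sg : Signature) (n : ℕ∞) : Set₁ where
  open Signature Sg
  field
    Car : ℕ → NomSetoid
  C : ℕ → Set
  C i = NomSetoid.Car (Car i)
  Eq : (i : ℕ) → C i → C i → Set
  Eq i = NomSetoid._≈_ (Car i)
  actA : (i : ℕ) → Perm → C i → C i
  actA i = NomSetoid.act (Car i)
  field
    op₀ : (f : Op₀) (m : ℕ) → .(m + d₀ f ≤̂ n) → Vec (C m) (ar₀ f) → C (m + d₀ f)
    opf : (g : Opf) (m : ℕ) → .(m + df g ≤̂ n) → 𝔸 → Vec (C m) (arf g) → C (m + df g)
    opb : (h : Opb) (m : ℕ) → .(m + db h ≤̂ n) → 𝔸 → Vec (C m) (arb h) → C (m + db h)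
    op₀-cong : ∀ f m .p {xs ys} → Pointwise (NomSetoid._≈_ (Car m)) xs ys →
               Eq (m + d₀ f) (op₀ f m p xs) (op₀ f m p ys)
    opf-cong : ∀ g m .p a {xs ys} → Pointwise (NomSetoid._≈_ (Car m)) xs ys →
               Eq (m + df g) (opf g m p a xs) (opf g m p a ys)
    -- opb is a map on [𝔸](A_m^p): it respects α-equivalence
    opb-cong : ∀ h m .p a b {xs ys} → AlphaEq (Car m) a xs b ys →
               Eq (m + db h) (opb h m p a xs) (opb h m p b ys)
    op₀-equiv : ∀ f m .p π xs →
                Eq (m + d₀ f) (op₀ f m p (actV (actA m) π xs)) (actA (m + d₀ f) π (op₀ f m p xs))
    opf-equiv : ∀ g m .p π a xs →
                Eq (m + df g) (opf g m p (fun π a) (actV (actA m) π xs)) (actA (m + df g) π (opf g m p a xs))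
    opb-equiv : ∀ h m .p π a xs →
                Eq (m + db h) (opb h m p (fun π a) (actV (actA m) π xs)) (actA (m + db h) π (opb h m p a xs))

record Hom {Sg : Signature} {n : ℕ∞} (A B : Algebra Sg n) : Set where
  open Signature Sg
  module A = Algebra A
  module B = Algebra B
  field
    hom : (i : ℕ) → .(i ≤̂ n) → A.C i → B.C i
    hom-cong : ∀ i .p {x y} → NomSetoid._≈_ (A.Car i) x y →
               NomSetoid._≈_ (B.Car i) (hom i p x) (hom i p y)
    hom-equiv : ∀ i .p π x →
                NomSetoid._≈_ (B.Car i) (hom i p (A.actA i π x)) (B.actA i π (hom i p x))
    hom-op₀ : ∀ f m .p xs →
      NomSetoid._≈_ (B.Car (m + d₀ f))
        (hom (m + d₀ f) p (A.op₀ f m p xs))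
        (B.op₀ f m p (map (hom m (≤̂-weaken (d₀ f) n p)) xs))
    hom-opf : ∀ g m .p a xs →
      NomSetoid._≈_ (B.Car (m + df g))
        (hom (m + df g) p (A.opf g m p a xs))
        (B.opf g m p a (map (hom m (≤̂-weaken (df g) n p)) xs))
    hom-opb : ∀ h m .p a xs →
      NomSetoid._≈_ (B.Car (m + db h))
        (hom (m + db h) p (A.opb h m p a xs))
        (B.opb h m p a (map (hom m (≤̂-weaken (db h) n p)) xs))

module Eval {Sg : Signature} {n : ℕ∞} (A : Algebra Sg n) {V : Set} {k : ℕ}
            (ι : V → Algebra.C A k) where
  open Signature Sg
  open Algebra A

  cast : ∀ {i j} → i ≡ j → C i → C j
  cast {i} {j} e = subst C e

  private
    lvl : ∀ m d → k + (m + d) ≤̂ n → (k + m) + d ≤̂ n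
    lvl m d q = subst (_≤̂ n) (sym (+-assoc k m d)) q
    down : ∀ m d → k + (m + d) ≤̂ n → k + m ≤̂ n
    down m d q = ≤̂-weaken d n (lvl m d q)

  mutual
    eval : ∀ {m} (t : Term Sg V) → UD Sg m t → .(k + m ≤̂ n) → C (k + m)
    eval (var x) (var .x) q = cast (sym (+-identityʳ k)) (ι x)
    eval (pure f ts) (pure {m} .f ps) q =
      cast (+-assoc k m (d₀ f)) (op₀ f (k + m) (lvl m (d₀ f) q) (evals ts ps (down m (d₀ f) q)))
    eval (free g a ts) (free {m} .g .a ps) q =
      cast (+-assoc k m (df g)) (opf g (k + m) (lvl m (df g) q) a (evals ts ps (down m (df g) q)))
    eval (bound h a ts) (bound {m} .h .a ps) q =
      cast (+-assoc k m (db h)) (opb h (k + m) (lvl m (db h) q) a (evals ts ps (down m (db h) q)))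

    evals : ∀ {m p} (ts : Vec (Term Sg V) p) → All (UD Sg m) ts → .(k + m ≤̂ n) → Vec (C (k + m)) p
    evals [] [] q = []
    evals (t ∷ ts) (u ∷ us) q = eval t u q ∷ evals ts us q

Satisfies : (T : Theory) {n : ℕ∞} → Algebra (Theory.sig T) n → Theory.Ax T → Set
Satisfies T {n} A e =
  ∀ k → .(q : k + depth e ≤̂ n) → (ι : NomType.Car (ctx e) → C k) →
  (∀ π y → NomSetoid._≈_ (Car k) (ι (NomType.act (ctx e) π y)) (actA k π (ι y))) →
  NomSetoid._≈_ (Car (k + depth e))
    (Eval.eval A ι (lhs e) (lhs-UD e) q) (Eval.eval A ι (rhs e) (rhs-UD e) q)
  where open Theory T
        open Algebra A

IsModel : (T : Theory) {n : ℕ∞} → Algebra (Theory.sig T) n → Set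
IsModel T A = ∀ e → Satisfies T A e

module TermAlgebra (T : Theory) (n : ℕ∞) (X : NomType) where
  open Theory T
  open Signature sig
  private
    V = NomType.Car X
    actX = NomType.act X

  FCar : ℕ → Set
  FCar i = Σ (Term sig V) (UD sig i)

  FEq : (i : ℕ) → FCar i → FCar i → Set
  FEq i t u = Deriv T X i (proj₁ t) (proj₁ u)

  FAct : (i : ℕ) → Perm → FCar i → FCar i
  FAct i π (t , q) = actT sig actX π t , actT-UD sig actX π q

  unzipT : ∀ {m p} → Vec (FCar m) p → Σ (Vec (Term sig V) p) (All (UD sig m))
  unzipT [] = [] , []
  unzipT ((t , q) ∷ ts) = let (us , qs) = unzipT ts in (t ∷ us) , (q ∷ qs)

  Fop₀ : (f : Op₀) (m : ℕ) → Vec (FCar m) (ar₀ f) → FCar (m + d₀ f)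
  Fop₀ f m ts = let (us , qs) = unzipT ts in pure f us , pure f qs

  Fopf : (g : Opf) (m : ℕ) → 𝔸 → Vec (FCar m) (arf g) → FCar (m + df g)
  Fopf g m a ts = let (us , qs) = unzipT ts in free g a us , free g a qs

  Fopb : (h : Opb) (m : ℕ) → 𝔸 → Vec (FCar m) (arb h) → FCar (m + db h)
  Fopb h m a ts = let (us , qs) = unzipT ts in bound h a us , bound h a qs

  FNS : (i : ℕ) → IsNomSetoid (FCar i) (FEq i) (FAct i) → NomSetoid
  FNS i L = record { Car = FCar i ; _≈_ = FEq i ; act = FAct i ; isNomSetoid = L }

  record Laws : Set where
    field
      nom : ∀ i → IsNomSetoid (FCar i) (FEq i) (FAct i)
    FN : ℕ → NomSetoid
    FN i = FNS i (nom i)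
    field
      op₀-cong : ∀ f m → .(m + d₀ f ≤̂ n) → ∀ {xs ys} → Pointwise (FEq m) xs ys →
                 FEq (m + d₀ f) (Fop₀ f m xs) (Fop₀ f m ys)
      opf-cong : ∀ g m → .(m + df g ≤̂ n) → ∀ a {xs ys} → Pointwise (FEq m) xs ys →
                 FEq (m + df g) (Fopf g m a xs) (Fopf g m a ys)
      opb-cong : ∀ h m → .(m + db h ≤̂ n) → ∀ a b {xs ys} → AlphaEq (FN m) a xs b ys →
                 FEq (m + db h) (Fopb h m a xs) (Fopb h m b ys)
      op₀-equiv : ∀ f m → .(m + d₀ f ≤̂ n) → ∀ π xs →
                  FEq (m + d₀ f) (Fop₀ f m (actV (FAct m) π xs)) (FAct (m + d₀ f) π (Fop₀ f m xs))
      opf-equiv : ∀ g m → .(m + df g ≤̂ n) → ∀ π a xs →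
                  FEq (m + df g) (Fopf g m (fun π a) (actV (FAct m) π xs)) (FAct (m + df g) π (Fopf g m a xs))
      opb-equiv : ∀ h m → .(m + db h ≤̂ n) → ∀ π a xs →
                  FEq (m + db h) (Fopb h m (fun π a) (actV (FAct m) π xs)) (FAct (m + db h) π (Fopb h m a xs))

  FX : Laws → Algebra sig n
  FX L = record
    { Car = Laws.FN L
    ; op₀ = λ f m _ → Fop₀ f m
    ; opf = λ g m _ → Fopf g m
    ; opb = λ h m _ → Fopb h m
    ; op₀-cong = λ f m p → Laws.op₀-cong L f m p
    ; opf-cong = λ g m p → Laws.opf-cong L g m p
    ; opb-cong = λ h m p → Laws.opb-cong L h m p
    ; op₀-equiv = λ f m p → Laws.op₀-equiv L f m p
    ; opf-equiv = λ g m p → Laws.opf-equiv L g m p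
    ; opb-equiv = λ h m p → Laws.opb-equiv L h m p
    }

  η : V → FCar 0
  η x = var x , var x

IsFree : (T : Theory) {n : ℕ∞} (X : NomType) (F : Algebra (Theory.sig T) n) →
         (NomType.Car X → Algebra.C F 0) → Set₁
IsFree T {n} X F e =
  (A : Algebra (Theory.sig T) n) → IsModel T A →
  (g : NomType.Car X → Algebra.C A 0) →
  (∀ π x → NomSetoid._≈_ (Algebra.Car A 0) (g (NomType.act X π x)) (Algebra.actA A 0 π (g x))) →
  Σ (Hom F A) λ h →
    (∀ x → NomSetoid._≈_ (Algebra.Car A 0) (Hom.hom h 0 (0≤̂ n) (e x)) (g x)) ×
    ((h′ : Hom F A) →
     (∀ x → NomSetoid._≈_ (Algebra.Car A 0) (Hom.hom h′ 0 (0≤̂ n) (e x)) (g x)) →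
     ∀ i → .(p : i ≤̂ n) → ∀ y →
     NomSetoid._≈_ (Algebra.Car A i) (Hom.hom h′ i p y) (Hom.hom h i p y))

module Submission where

-- Derivable equality is an equivariant congruence closed under instances of
-- the axioms, so the quotient term algebra FX is a (T,n)-model; that its
-- ν-operations respect α-equivalence comes from the (perm) rule, after
-- renaming the bound name to a syntactically fresh one.  Conversely, in any
-- model every rule of the calculus is sound for the evaluation of terms under
-- g: (ax) by the substitution lemma and equivariance of evaluation, (perm) by
-- the identity ⟨a⟩((a b)·x) = ⟨b⟩x for a # x.  Hence evaluation is a
-- homomorphism FX → A extending g, and any such homomorphism agrees with it
-- by induction on terms.

open import Defs
open import Data.Empty using (⊥-elim)
open import Data.List using (List; []; _∷_; _++_)
import Data.List as List
open import Data.List.Extrema.Nat using (max; xs≤max)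
open import Data.List.Membership.Propositional using (_∈_; _∉_)
open import Data.List.Membership.Propositional.Properties using (∈-++⁺ˡ; ∈-++⁺ʳ; ∈-++⁻; ∈-map⁺; ∈-map⁻)
import Data.List.Relation.Unary.All as ListAll
open import Data.List.Relation.Unary.Any using (here; there)
open import Data.Nat using (ℕ; suc; _+_; _≟_; _≤?_)
open import Data.Nat.Properties using (+-assoc; +-identityʳ; +-comm; +-cancelʳ-≡; 1+n≰n; m≤n+m)
open import Data.Product using (Σ; _×_; _,_; proj₁; proj₂)
open import Data.Sum using (inj₁; inj₂)
open import Data.Unit using (tt)
open import Data.Vec using (Vec; []; _∷_; map)
open import Data.Vec.Relation.Binary.Pointwise.Inductive as Pointwise using (Pointwise; []; _∷_)
open import Data.Vec.Relation.Unary.All using (All; []; _∷_)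
open import Function using (_∘_)
open import Relation.Binary using (IsEquivalence)
open import Relation.Binary.PropositionalEquality using (_≡_; refl; sym; trans; cong; cong₂; subst)
import Relation.Binary.PropositionalEquality as ≡
open import Relation.Nullary using (¬_; yes; no)
open import Relation.Nullary.Decidable using (recompute)

fresh : List 𝔸 → 𝔸
fresh as = suc (max 0 as)

fresh-∉ : ∀ as → fresh as ∉ as
fresh-∉ as a∈as = 1+n≰n (ListAll.lookup (xs≤max 0 as) a∈as)

∉-++⁺ : ∀ {a : 𝔸} S {S′} → a ∉ S → a ∉ S′ → a ∉ S ++ S′
∉-++⁺ S a∉S a∉S′ a∈ with ∈-++⁻ S a∈
... | inj₁ a∈S = a∉S a∈S
... | inj₂ a∈S′ = a∉S′ a∈S′

≤̂-recompute : ∀ {i} n → .(i ≤̂ n) → i ≤̂ n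
≤̂-recompute {i} (fin N) q = recompute (i ≤? N) q
≤̂-recompute ω q = tt

invP : Perm → Perm
invP π = record
  { fun = inv π ; inv = fun π ; left = right π ; right = left π ; dom = dom π
  ; finite = λ a a∉ → trans (cong (inv π) (sym (finite π a a∉))) (left π a) }

fun-injective : ∀ π {a b} → fun π a ≡ fun π b → a ≡ b
fun-injective π {a} {b} e = trans (sym (left π a)) (trans (cong (inv π) e) (left π b))

fun-∉-map : ∀ π {a S} → a ∉ S → fun π a ∉ List.map (fun π) S
fun-∉-map π a∉S πa∈ with ∈-map⁻ (fun π) πa∈
... | s , s∈S , πa≡πs = a∉S (subst (_∈ _) (sym (fun-injective π πa≡πs)) s∈S)

fixes-++ˡ : ∀ {π} S {S′} → Fixes π (S ++ S′) → Fixes π S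
fixes-++ˡ S fx a a∈ = fx a (∈-++⁺ˡ a∈)

fixes-++ʳ : ∀ {π} S {S′} → Fixes π (S ++ S′) → Fixes π S′
fixes-++ʳ S fx a a∈ = fx a (∈-++⁺ʳ S a∈)

swap-left : ∀ a b → fun (swap a b) a ≡ b
swap-left a b with a ≟ a
... | yes _ = refl
... | no a≢a = ⊥-elim (a≢a refl)

swap-right : ∀ a b → fun (swap a b) b ≡ a
swap-right a b with b ≟ a
... | yes b≡a = b≡a
... | no _ with b ≟ b
...   | yes _ = refl
...   | no b≢b = ⊥-elim (b≢b refl)

swap-other : ∀ a b c → ¬ c ≡ a → ¬ c ≡ b → fun (swap a b) c ≡ c
swap-other a b c c≢a c≢b with c ≟ a
... | yes c≡a = ⊥-elim (c≢a c≡a)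
... | no _ with c ≟ b
...   | yes c≡b = ⊥-elim (c≢b c≡b)
...   | no _ = refl

swap-involutive : ∀ a b c → fun (swap a b) (fun (swap a b) c) ≡ c
swap-involutive a b = left (swap a b)

swap-comm : ∀ a b c → fun (swap a b) c ≡ fun (swap b a) c
swap-comm a b c with a ≟ c | b ≟ c
... | yes refl | yes refl = refl
... | yes refl | no _ = trans (swap-left a b) (sym (swap-right b a))
... | no _ | yes refl = trans (swap-right a b) (sym (swap-left b a))
... | no a≢c | no b≢c =
  trans (swap-other a b c (a≢c ∘ sym) (b≢c ∘ sym)) (sym (swap-other b a c (b≢c ∘ sym) (a≢c ∘ sym)))

swap-conjugate : ∀ π a b c → fun π (fun (swap a b) c) ≡ fun (swap (fun π a) (fun π b)) (fun π c)
swap-conjugate π a b c with a ≟ c | b ≟ c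
... | yes refl | _ = trans (cong (fun π) (swap-left a b)) (sym (swap-left (fun π a) (fun π b)))
... | no _ | yes refl = trans (cong (fun π) (swap-right a b)) (sym (swap-right (fun π a) (fun π b)))
... | no a≢c | no b≢c =
  trans (cong (fun π) (swap-other a b c (a≢c ∘ sym) (b≢c ∘ sym)))
        (sym (swap-other _ _ _ (a≢c ∘ sym ∘ fun-injective π) (b≢c ∘ sym ∘ fun-injective π)))

swap-∘-swap : ∀ a b c s → ¬ s ≡ a → ¬ s ≡ c → fun (swap c a) (fun (swap a b) s) ≡ fun (swap c b) s
swap-∘-swap a b c s s≢a s≢c with b ≟ s
... | yes refl = trans (cong (fun (swap c a)) (swap-right a b)) (trans (swap-right c a) (sym (swap-right c b)))
... | no b≢s =
  trans (cong (fun (swap c a)) (swap-other a b s s≢a (b≢s ∘ sym)))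
        (trans (swap-other c a s s≢c s≢a) (sym (swap-other c b s s≢c (b≢s ∘ sym))))

module NomSetoidProperties {C : Set} {_≈_ : C → C → Set} {act : Perm → C → C}
                           (N : IsNomSetoid C _≈_ act) where
  open IsNomSetoid N public
  open IsEquivalence isEquivalence public
    renaming (refl to ≈-refl; sym to ≈-sym; trans to ≈-trans; reflexive to ≈-reflexive)

  act-agree : ∀ {S x} → Supports _≈_ act S x →
              ∀ π ρ → (∀ a → a ∈ S → fun π a ≡ fun ρ a) → act π x ≈ act ρ x
  act-agree {S} {x} sup π ρ π≗ρ =
    ≈-trans (act-ext π (ρ ∘P μ) (λ a → sym (right ρ (fun π a))) x)
            (≈-trans (act-∘ ρ μ x) (act-cong ρ (sup μ μ-fixes)))
    where
      μ = invP ρ ∘P π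
      μ-fixes : Fixes μ S
      μ-fixes a a∈S = trans (cong (inv ρ) (π≗ρ a a∈S)) (left ρ a)

  supports-act : ∀ {S x} π → Supports _≈_ act S x → Supports _≈_ act (List.map (fun π) S) (act π x)
  supports-act {S} {x} π sup ρ fx =
    ≈-trans (≈-sym (act-∘ ρ π x))
            (act-agree sup (ρ ∘P π) π (λ a a∈S → fx (fun π a) (∈-map⁺ (fun π) a∈S)))

  fresh-act : ∀ π {a x} → Fresh _≈_ act a x → Fresh _≈_ act (fun π a) (act π x)
  fresh-act π (S , a∉S , sup) = List.map (fun π) S , fun-∉-map π a∉S , supports-act π sup

module NomTypeProperties (Z : NomType) where
  open NomType Z

  isNomSetoid : IsNomSetoid Car _≡_ act
  isNomSetoid = record
    { isEquivalence = ≡.isEquivalence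
    ; act-cong = λ π → cong (act π)
    ; act-id = act-id ; act-∘ = act-∘ ; act-ext = act-ext ; finSupp = finSupp }

  act-act : ∀ π ρ μ → (∀ a → fun π (fun ρ a) ≡ fun μ a) → ∀ y → act π (act ρ y) ≡ act μ y
  act-act π ρ μ πρ≗μ y = trans (sym (act-∘ π ρ y)) (act-ext (π ∘P ρ) μ πρ≗μ y)

  act-invP : ∀ π y → act (invP π) (act π y) ≡ y
  act-invP π y = trans (act-act (invP π) π idP (left π) y) (act-id y)

  act-swap-involutive : ∀ a b y → act (swap a b) (act (swap a b) y) ≡ y
  act-swap-involutive a b y = trans (act-act (swap a b) (swap a b) idP (swap-involutive a b) y) (act-id y)

  act-swap-comm : ∀ a b y → act (swap a b) y ≡ act (swap b a) y
  act-swap-comm a b = act-ext (swap a b) (swap b a) (swap-comm a b)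

  act-swap-conjugate : ∀ π a b y →
                       act π (act (swap a b) y) ≡ act (swap (fun π a) (fun π b)) (act π y)
  act-swap-conjugate π a b y =
    trans (act-act π (swap a b) (swap (fun π a) (fun π b) ∘P π) (swap-conjugate π a b) y)
          (act-∘ (swap (fun π a) (fun π b)) π y)

module VecNomSetoid {C : Set} {_≈_ : C → C → Set} {act : Perm → C → C}
                    (N : IsNomSetoid C _≈_ act) where
  open NomSetoidProperties N

  private
    act-idV : ∀ {p} (xs : Vec C p) → Pointwise _≈_ (actV act idP xs) xs
    act-idV [] = []
    act-idV (x ∷ xs) = act-id x ∷ act-idV xs

    act-∘V : ∀ π ρ {p} (xs : Vec C p) → Pointwise _≈_ (actV act (π ∘P ρ) xs) (actV act π (actV act ρ xs))
    act-∘V π ρ [] = []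
    act-∘V π ρ (x ∷ xs) = act-∘ π ρ x ∷ act-∘V π ρ xs

    act-extV : ∀ π ρ → (∀ a → fun π a ≡ fun ρ a) → ∀ {p} (xs : Vec C p) →
               Pointwise _≈_ (actV act π xs) (actV act ρ xs)
    act-extV π ρ π≗ρ [] = []
    act-extV π ρ π≗ρ (x ∷ xs) = act-ext π ρ π≗ρ x ∷ act-extV π ρ π≗ρ xs

    finSuppV : ∀ {p} (xs : Vec C p) → Σ (List 𝔸) λ S → Supports (Pointwise _≈_) (actV act) S xs
    finSuppV [] = [] , λ _ _ → []
    finSuppV (x ∷ xs) with finSupp x | finSuppV xs
    ... | S , sup | S′ , sup′ = S ++ S′ , λ π fx → sup π (fixes-++ˡ {π} S fx) ∷ sup′ π (fixes-++ʳ {π} S fx)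

  isNomSetoidV : ∀ p → IsNomSetoid (Vec C p) (Pointwise _≈_) (actV act)
  isNomSetoidV p = record
    { isEquivalence = Pointwise.isEquivalence isEquivalence p
    ; act-cong = λ π → Pointwise.map⁺ (act-cong π)
    ; act-id = act-idV ; act-∘ = λ π ρ → act-∘V π ρ
    ; act-ext = λ π ρ π≗ρ → act-extV π ρ π≗ρ ; finSupp = finSuppV }

  fresh-all : ∀ {a p} {xs : Vec C p} → All (Fresh _≈_ act a) xs → FreshV _≈_ act a xs
  fresh-all [] = [] , (λ ()) , λ _ _ → []
  fresh-all ((S , a∉S , sup) ∷ frs) with fresh-all frs
  ... | S′ , a∉S′ , sup′ =
    S ++ S′ , ∉-++⁺ S a∉S a∉S′ , λ π fx → sup π (fixes-++ˡ {π} S fx) ∷ sup′ π (fixes-++ʳ {π} S fx)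

module AlphaEquivalence (A : NomSetoid) where
  open NomSetoid A
  open VecNomSetoid isNomSetoid
  module V {p} = NomSetoidProperties (isNomSetoidV p)

  alphaEq-cong : ∀ a {p} {xs ys : Vec Car p} → Pointwise _≈_ xs ys → AlphaEq A a xs a ys
  alphaEq-cong a {xs = xs} {ys} xs≈ys with V.finSupp xs | V.finSupp ys
  ... | S , sup | S′ , sup′ =
    c , c≢a , c≢a , (S , c∉S , sup) , (S′ , c∉S′ , sup′) , V.act-cong (swap c a) xs≈ys
    where
      c = fresh (a ∷ S ++ S′)
      c≢a = λ c≡a → fresh-∉ (a ∷ S ++ S′) (here c≡a)
      c∉S = λ c∈S → fresh-∉ (a ∷ S ++ S′) (there (∈-++⁺ˡ c∈S))
      c∉S′ = λ c∈S′ → fresh-∉ (a ∷ S ++ S′) (there (∈-++⁺ʳ S c∈S′))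

  alphaEq-swap : ∀ a b {p} (xs : Vec Car p) → FreshV _≈_ act a xs →
                 AlphaEq A a (actV act (swap a b) xs) b xs
  alphaEq-swap a b xs (S , a∉S , sup) =
    c , c≢a , c≢b
      , subst (λ d → FreshV _≈_ act d _) (swap-other a b c c≢a c≢b) (V.fresh-act (swap a b) c#xs)
      , c#xs
      , V.≈-trans (V.≈-sym (V.act-∘ (swap c a) (swap a b) xs))
                  (V.act-agree sup (swap c a ∘P swap a b) (swap c b)
                     (λ s s∈S → swap-∘-swap a b c s (λ s≡a → a∉S (subst (_∈ S) s≡a s∈S))
                                                    (λ s≡c → c∉S (subst (_∈ S) s≡c s∈S))))
    where
      c = fresh (a ∷ b ∷ S)
      c≢a = λ c≡a → fresh-∉ (a ∷ b ∷ S) (here c≡a)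
      c≢b = λ c≡b → fresh-∉ (a ∷ b ∷ S) (there (here c≡b))
      c∉S = λ c∈S → fresh-∉ (a ∷ b ∷ S) (there (there c∈S))
      c#xs = S , c∉S , sup

module TermAction (Sg : Signature) (Z : NomType) where
  open Signature Sg
  private
    actZ = NomType.act Z

  Tm : Set
  Tm = Term Sg (NomType.Car Z)

  aT : Perm → Tm → Tm
  aT = actT Sg actZ

  aTs : ∀ {p} → Perm → Vec Tm p → Vec Tm p
  aTs = actTs Sg actZ

  mutual
    aT-id : ∀ t → aT idP t ≡ t
    aT-id (var x) = cong var (NomType.act-id Z x)
    aT-id (pure f ts) = cong (pure f) (aTs-id ts)
    aT-id (free g a ts) = cong (free g a) (aTs-id ts)
    aT-id (bound h a ts) = cong (bound h a) (aTs-id ts)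

    aTs-id : ∀ {p} (ts : Vec Tm p) → aTs idP ts ≡ ts
    aTs-id [] = refl
    aTs-id (t ∷ ts) = cong₂ _∷_ (aT-id t) (aTs-id ts)

  mutual
    aT-∘ : ∀ π ρ t → aT (π ∘P ρ) t ≡ aT π (aT ρ t)
    aT-∘ π ρ (var x) = cong var (NomType.act-∘ Z π ρ x)
    aT-∘ π ρ (pure f ts) = cong (pure f) (aTs-∘ π ρ ts)
    aT-∘ π ρ (free g a ts) = cong (free g _) (aTs-∘ π ρ ts)
    aT-∘ π ρ (bound h a ts) = cong (bound h _) (aTs-∘ π ρ ts)

    aTs-∘ : ∀ π ρ {p} (ts : Vec Tm p) → aTs (π ∘P ρ) ts ≡ aTs π (aTs ρ ts)
    aTs-∘ π ρ [] = refl
    aTs-∘ π ρ (t ∷ ts) = cong₂ _∷_ (aT-∘ π ρ t) (aTs-∘ π ρ ts)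

  mutual
    aT-ext : ∀ π ρ → (∀ a → fun π a ≡ fun ρ a) → ∀ t → aT π t ≡ aT ρ t
    aT-ext π ρ π≗ρ (var x) = cong var (NomType.act-ext Z π ρ π≗ρ x)
    aT-ext π ρ π≗ρ (pure f ts) = cong (pure f) (aTs-ext π ρ π≗ρ ts)
    aT-ext π ρ π≗ρ (free g a ts) = cong₂ (free g) (π≗ρ a) (aTs-ext π ρ π≗ρ ts)
    aT-ext π ρ π≗ρ (bound h a ts) = cong₂ (bound h) (π≗ρ a) (aTs-ext π ρ π≗ρ ts)

    aTs-ext : ∀ π ρ → (∀ a → fun π a ≡ fun ρ a) → ∀ {p} (ts : Vec Tm p) → aTs π ts ≡ aTs ρ ts
    aTs-ext π ρ π≗ρ [] = refl
    aTs-ext π ρ π≗ρ (t ∷ ts) = cong₂ _∷_ (aT-ext π ρ π≗ρ t) (aTs-ext π ρ π≗ρ ts)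

  mutual
    suppT : Tm → List 𝔸
    suppT (var x) = proj₁ (NomType.finSupp Z x)
    suppT (pure f ts) = suppTs ts
    suppT (free g a ts) = a ∷ suppTs ts
    suppT (bound h a ts) = a ∷ suppTs ts

    suppTs : ∀ {p} → Vec Tm p → List 𝔸
    suppTs [] = []
    suppTs (t ∷ ts) = suppT t ++ suppTs ts

  mutual
    suppT-supports : ∀ t → Supports _≡_ aT (suppT t) t
    suppT-supports (var x) π fx = cong var (proj₂ (NomType.finSupp Z x) π fx)
    suppT-supports (pure f ts) π fx = cong (pure f) (suppTs-supports ts π fx)
    suppT-supports (free g a ts) π fx =
      cong₂ (free g) (fx a (here refl)) (suppTs-supports ts π (λ b b∈ → fx b (there b∈)))
    suppT-supports (bound h a ts) π fx =
      cong₂ (bound h) (fx a (here refl)) (suppTs-supports ts π (λ b b∈ → fx b (there b∈)))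

    suppTs-supports : ∀ {p} (ts : Vec Tm p) π → Fixes π (suppTs ts) → aTs π ts ≡ ts
    suppTs-supports [] π fx = refl
    suppTs-supports (t ∷ ts) π fx =
      cong₂ _∷_ (suppT-supports t π (fixes-++ˡ {π} (suppT t) fx))
                (suppTs-supports ts π (fixes-++ʳ {π} (suppT t) fx))

  Terms : NomType
  Terms = record
    { Car = Tm ; act = aT ; act-id = aT-id ; act-∘ = aT-∘ ; act-ext = aT-ext
    ; finSupp = λ t → suppT t , suppT-supports t }

module _ (Sg : Signature) {Y X : NomType} where
  private
    actX = NomType.act X
    actY = NomType.act Y

  mutual
    actT-substT : ∀ π (σ σ′ : NomType.Car Y → Term Sg (NomType.Car X)) →
                  (∀ y → σ′ (actY π y) ≡ actT Sg actX π (σ y)) →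
                  ∀ t → actT Sg actX π (substT Sg σ t) ≡ substT Sg σ′ (actT Sg actY π t)
    actT-substT π σ σ′ σ′-act (var y) = sym (σ′-act y)
    actT-substT π σ σ′ σ′-act (pure f ts) = cong (pure f) (actTs-substTs π σ σ′ σ′-act ts)
    actT-substT π σ σ′ σ′-act (free g a ts) = cong (free g _) (actTs-substTs π σ σ′ σ′-act ts)
    actT-substT π σ σ′ σ′-act (bound h a ts) = cong (bound h _) (actTs-substTs π σ σ′ σ′-act ts)

    actTs-substTs : ∀ π (σ σ′ : NomType.Car Y → Term Sg (NomType.Car X)) →
                    (∀ y → σ′ (actY π y) ≡ actT Sg actX π (σ y)) →
                    ∀ {p} (ts : Vec (Term Sg (NomType.Car Y)) p) →
                    actTs Sg actX π (substTs Sg σ ts) ≡ substTs Sg σ′ (actTs Sg actY π ts)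
    actTs-substTs π σ σ′ σ′-act [] = refl
    actTs-substTs π σ σ′ σ′-act (t ∷ ts) =
      cong₂ _∷_ (actT-substT π σ σ′ σ′-act t) (actTs-substTs π σ σ′ σ′-act ts)

module _ (Sg : Signature) {V W : Set} (σ : V → Term Sg W) {l : ℕ} (σ-UD : ∀ y → UD Sg l (σ y)) where
  open Signature Sg

  mutual
    substT-UD : ∀ {m t} → UD Sg m t → UD Sg (l + m) (substT Sg σ t)
    substT-UD (var y) = subst (λ j → UD Sg j (σ y)) (sym (+-identityʳ l)) (σ-UD y)
    substT-UD (pure {m} f {ts} ps) =
      subst (λ j → UD Sg j (pure f (substTs Sg σ ts))) (+-assoc l m (d₀ f)) (pure f (substTs-UD ps))
    substT-UD (free {m} g a {ts} ps) =
      subst (λ j → UD Sg j (free g a (substTs Sg σ ts))) (+-assoc l m (df g)) (free g a (substTs-UD ps))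
    substT-UD (bound {m} h a {ts} ps) =
      subst (λ j → UD Sg j (bound h a (substTs Sg σ ts))) (+-assoc l m (db h)) (bound h a (substTs-UD ps))

    substTs-UD : ∀ {m p} {ts : Vec (Term Sg V) p} → All (UD Sg m) ts → All (UD Sg (l + m)) (substTs Sg σ ts)
    substTs-UD [] = []
    substTs-UD (p ∷ ps) = substT-UD p ∷ substTs-UD ps

Deriv-≡ : ∀ {T X m t t′ u u′} → t ≡ t′ → u ≡ u′ → Deriv T X m t′ u′ → Deriv T X m t u
Deriv-≡ refl refl d = d

module Derivations (T : Theory) (X : NomType) where
  open Theory T
  open Signature sig
  open TermAction sig X
  open NomTypeProperties Terms
  private
    D = Deriv T X
    aX = NomType.act X

  mutual
    Deriv-refl : ∀ {m t} → UD sig m t → D m t t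
    Deriv-refl (var x) = refl′ x
    Deriv-refl (pure f ps) = cong₀ f (Deriv-refls ps)
    Deriv-refl (free g a ps) = congf g a (Deriv-refls ps)
    Deriv-refl (bound h a ps) = congb h a (Deriv-refls ps)

    Deriv-refls : ∀ {m p} {ts : Vec Tm p} → All (UD sig m) ts → Pointwise (D m) ts ts
    Deriv-refls [] = []
    Deriv-refls (p ∷ ps) = Deriv-refl p ∷ Deriv-refls ps

  Deriv-reflexive : ∀ {m t u} → t ≡ u → UD sig m u → D m t u
  Deriv-reflexive t≡u p = Deriv-≡ t≡u refl (Deriv-refl p)

  mutual
    Deriv-UD : ∀ {m t u} → D m t u → UD sig m t × UD sig m u
    Deriv-UD (refl′ x) = var x , var x
    Deriv-UD (symm d) = proj₂ (Deriv-UD d) , proj₁ (Deriv-UD d)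
    Deriv-UD (trans′ d e) = proj₁ (Deriv-UD d) , proj₂ (Deriv-UD e)
    Deriv-UD (cong₀ f ds) = pure f (proj₁ (Deriv-UDs ds)) , pure f (proj₂ (Deriv-UDs ds))
    Deriv-UD (congf g a ds) = free g a (proj₁ (Deriv-UDs ds)) , free g a (proj₂ (Deriv-UDs ds))
    Deriv-UD (congb h a ds) = bound h a (proj₁ (Deriv-UDs ds)) , bound h a (proj₂ (Deriv-UDs ds))
    Deriv-UD (ax e τ {l} σ σ-UD _) = instance-UD (lhs-UD e) , instance-UD (rhs-UD e)
      where
        actY = NomType.act (ctx e)
        instance-UD : ∀ {r} → UD sig (depth e) r → UD sig (depth e + l) (substT sig σ (actT sig actY τ r))
        instance-UD {r} p = subst (λ j → UD sig j (substT sig σ (actT sig actY τ r))) (+-comm l (depth e))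
                                  (substT-UD sig σ σ-UD (actT-UD sig actY τ p))
    Deriv-UD (perm h a b _ _ ds) = bound h a (proj₁ (Deriv-UDs-swap a b ds)) , bound h b (proj₂ (Deriv-UDs-swap a b ds))

    Deriv-UDs : ∀ {m p} {ts us : Vec Tm p} → Pointwise (D m) ts us → All (UD sig m) ts × All (UD sig m) us
    Deriv-UDs [] = [] , []
    Deriv-UDs (d ∷ ds) = (proj₁ (Deriv-UD d) ∷ proj₁ (Deriv-UDs ds)) , (proj₂ (Deriv-UD d) ∷ proj₂ (Deriv-UDs ds))

    Deriv-UDs-swap : ∀ {m p} a b {ts us : Vec Tm p} → Pointwise (λ t u → D m t (aT (swap a b) u)) ts us →
                     All (UD sig m) ts × All (UD sig m) us
    Deriv-UDs-swap a b [] = [] , []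
    Deriv-UDs-swap a b {us = u ∷ _} (d ∷ ds) =
      (proj₁ (Deriv-UD d) ∷ proj₁ (Deriv-UDs-swap a b ds)) ,
      (subst (UD sig _) (act-swap-involutive a b u) (actT-UD sig aX (swap a b) (proj₂ (Deriv-UD d)))
        ∷ proj₂ (Deriv-UDs-swap a b ds))

  mutual
    Deriv-act : ∀ {m t u} → D m t u → ∀ π → D m (aT π t) (aT π u)
    Deriv-act (refl′ x) π = refl′ (aX π x)
    Deriv-act (symm d) π = symm (Deriv-act d π)
    Deriv-act (trans′ d e) π = trans′ (Deriv-act d π) (Deriv-act e π)
    Deriv-act (cong₀ f ds) π = cong₀ f (Deriv-acts ds π)
    Deriv-act (congf g a ds) π = congf g (fun π a) (Deriv-acts ds π)
    Deriv-act (congb h a ds) π = congb h (fun π a) (Deriv-acts ds π)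
    Deriv-act (ax e τ {l} σ σ-UD side) π =
      Deriv-≡ (instance-act (lhs e)) (instance-act (rhs e))
              (ax e (π ∘P τ) σ′ (λ y → actT-UD sig aX π (σ-UD _)) side′)
      where
        module Y = NomTypeProperties (ctx e)
        actY = NomType.act (ctx e)

        -- the substitution y ↦ π·σ(π⁻¹·y), which instantiates (π ∘ τ)·axiom to π·(τ·axiom)[σ]
        σ′ : NomType.Car (ctx e) → Tm
        σ′ y = aT π (σ (actY (invP π) y))

        instance-act : ∀ r → aT π (substT sig σ (actT sig actY τ r)) ≡ substT sig σ′ (actT sig actY (π ∘P τ) r)
        instance-act r =
          trans (actT-substT sig {ctx e} {X} π σ σ′ (λ y → cong (aT π ∘ σ) (Y.act-invP π y)) (actT sig actY τ r))
                (cong (substT sig σ′) (sym (TermAction.aT-∘ sig (ctx e) π τ r)))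

        side′ : ∀ ρ y → D l (aT ρ (σ′ y)) (σ′ (actY ρ y))
        side′ ρ y = Deriv-≡ lhs≡ rhs≡ (Deriv-act (side ρ′ y′) π)
          where
            ρ′ = invP π ∘P (ρ ∘P π)
            y′ = actY (invP π) y
            lhs≡ : aT ρ (σ′ y) ≡ aT π (aT ρ′ (σ y′))
            lhs≡ = trans (act-act ρ π (ρ ∘P π) (λ _ → refl) (σ y′))
                         (sym (act-act π ρ′ (ρ ∘P π) (λ a → right π _) (σ y′)))
            rhs≡ : σ′ (actY ρ y) ≡ aT π (σ (actY ρ′ y′))
            rhs≡ = cong (aT π ∘ σ)
                     (trans (Y.act-act (invP π) ρ (invP π ∘P ρ) (λ _ → refl) y)
                            (sym (Y.act-act ρ′ (invP π) (invP π ∘P ρ) (λ a → cong (inv π ∘ fun ρ) (right π a)) y)))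
    Deriv-act (perm h a b a≢b a#us ds) π =
      perm h (fun π a) (fun π b) (a≢b ∘ fun-injective π) (fresh-acts a#us) (Deriv-acts-swap a b ds π)
      where
        fresh-acts : ∀ {p} {us : Vec Tm p} → All (FreshT T X a) us → All (FreshT T X (fun π a)) (aTs π us)
        fresh-acts [] = []
        fresh-acts (a#u ∷ a#us) = NomSetoidProperties.fresh-act isNomSetoid π a#u ∷ fresh-acts a#us

    Deriv-acts : ∀ {m p} {ts us : Vec Tm p} → Pointwise (D m) ts us → ∀ π → Pointwise (D m) (aTs π ts) (aTs π us)
    Deriv-acts [] π = []
    Deriv-acts (d ∷ ds) π = Deriv-act d π ∷ Deriv-acts ds π

    Deriv-acts-swap : ∀ {m p} a b {ts us : Vec Tm p} → Pointwise (λ t u → D m t (aT (swap a b) u)) ts us →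
                      ∀ π → Pointwise (λ t u → D m t (aT (swap (fun π a) (fun π b)) u)) (aTs π ts) (aTs π us)
    Deriv-acts-swap a b [] π = []
    Deriv-acts-swap a b {us = u ∷ _} (d ∷ ds) π =
      Deriv-≡ refl (sym (act-swap-conjugate π a b u)) (Deriv-act d π) ∷ Deriv-acts-swap a b ds π

module TermAlgebraLaws (T : Theory) (n : ℕ∞) (X : NomType) where
  open Theory T
  open Signature sig
  open TermAlgebra T n X
  open TermAction sig X
  open NomTypeProperties Terms
  open Derivations T X
  private
    D = Deriv T X
    aX = NomType.act X

  terms : ∀ {m p} → Vec (FCar m) p → Vec Tm p
  terms xs = proj₁ (unzipT xs)

  terms-act : ∀ {m p} π (xs : Vec (FCar m) p) → terms (actV (FAct m) π xs) ≡ aTs π (terms xs)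
  terms-act π [] = refl
  terms-act π (x ∷ xs) = cong (_ ∷_) (terms-act π xs)

  terms-Deriv : ∀ {m p} {xs ys : Vec (FCar m) p} → Pointwise (FEq m) xs ys → Pointwise (D m) (terms xs) (terms ys)
  terms-Deriv [] = []
  terms-Deriv (d ∷ ds) = d ∷ terms-Deriv ds

  FCar-isNomSetoid : ∀ i → IsNomSetoid (FCar i) (FEq i) (FAct i)
  FCar-isNomSetoid i = record
    { isEquivalence = record { refl = λ {t} → Deriv-refl (proj₂ t) ; sym = symm ; trans = trans′ }
    ; act-cong = λ π d → Deriv-act d π
    ; act-id = λ t → Deriv-reflexive (aT-id (proj₁ t)) (proj₂ t)
    ; act-∘ = λ π ρ t → Deriv-reflexive (aT-∘ π ρ (proj₁ t)) (actT-UD sig aX π (actT-UD sig aX ρ (proj₂ t)))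
    ; act-ext = λ π ρ π≗ρ t → Deriv-reflexive (aT-ext π ρ π≗ρ (proj₁ t)) (actT-UD sig aX ρ (proj₂ t))
    ; finSupp = λ t → suppT (proj₁ t) , λ π fx → Deriv-reflexive (suppT-supports (proj₁ t) π fx) (proj₂ t)
    }

  fresh-renamed : ∀ a c d {p} (ts : Vec Tm p) → d ∉ suppTs ts →
                  All (FreshT T X a) (aTs (swap c a) (aTs (swap c d) ts))
  fresh-renamed a c d [] d∉ = []
  fresh-renamed a c d (t ∷ ts) d∉ = a#t ∷ fresh-renamed a c d ts (d∉ ∘ ∈-++⁺ʳ (suppT t))
    where
      open NomSetoidProperties isNomSetoid using (fresh-act)
      d#t : FreshT T X d t
      d#t = suppT t , d∉ ∘ ∈-++⁺ˡ , suppT-supports t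
      c#t′ : FreshT T X c (aT (swap c d) t)
      c#t′ = subst (λ b → FreshT T X b (aT (swap c d) t)) (swap-right c d) (fresh-act (swap c d) d#t)
      a#t = subst (λ b → FreshT T X b (aT (swap c a) (aT (swap c d) t))) (swap-left c a) (fresh-act (swap c a) c#t′)

  perm-premise-refl : ∀ {m} a c {p} {ts : Vec Tm p} → All (UD sig m) ts →
              Pointwise (λ t u → D m t (aT (swap a c) u)) ts (aTs (swap c a) ts)
  perm-premise-refl a c [] = []
  perm-premise-refl a c {ts = t ∷ _} (p ∷ ps) =
    Deriv-≡ refl (trans (act-swap-comm a c _) (act-swap-involutive c a t)) (Deriv-refl p) ∷ perm-premise-refl a c ps

  -- The (perm) rule needs c syntactically fresh, while c # xs only holds up to
  -- derivable equality; so c is first traded for a syntactically fresh d.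
  bound-rename : ∀ h {m} a c (xs : Vec (FCar m) (arb h)) → ¬ c ≡ a → FreshV (FEq m) (FAct m) c xs →
                 D (m + db h) (bound h a (terms xs)) (bound h c (terms (actV (FAct m) (swap c a) xs)))
  bound-rename h {m} a c xs c≢a (S , c∉S , c#xs) =
    Deriv-≡ refl (cong (bound h c) (terms-act (swap c a) xs))
      (trans′ (congb h a ts≈ts′)
        (trans′ (perm h a c (c≢a ∘ sym) (fresh-renamed a c d ts d∉ts)
                      (perm-premise-refl a c (actTs-UD sig aX (swap c d) ps)))
                (congb h c (Deriv-acts (Pointwise.sym symm ts≈ts′) (swap c a)))))
    where
      ts = terms xs
      ps = proj₂ (unzipT xs)
      d = fresh (S ++ suppTs ts)
      d∉S = fresh-∉ (S ++ suppTs ts) ∘ ∈-++⁺ˡ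
      d∉ts = fresh-∉ (S ++ suppTs ts) ∘ ∈-++⁺ʳ S
      cd-fixes-S : Fixes (swap c d) S
      cd-fixes-S s s∈S =
        swap-other c d s (λ s≡c → c∉S (subst (_∈ S) s≡c s∈S)) (λ s≡d → d∉S (subst (_∈ S) s≡d s∈S))
      ts≈ts′ : Pointwise (D m) ts (aTs (swap c d) ts)
      ts≈ts′ = Pointwise.sym symm (subst (λ us → Pointwise (D m) us ts) (terms-act (swap c d) xs)
                                         (terms-Deriv (c#xs (swap c d) cd-fixes-S)))

  laws : Laws
  laws = record
    { nom = FCar-isNomSetoid
    ; op₀-cong = λ f m _ xs≈ys → cong₀ f (terms-Deriv xs≈ys)
    ; opf-cong = λ g m _ a xs≈ys → congf g a (terms-Deriv xs≈ys)
    ; opb-cong = λ h m _ a b → λ { (c , c≢a , c≢b , c#xs , c#ys , xs≈ys) →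
        trans′ (bound-rename h a c _ c≢a c#xs)
               (trans′ (congb h c (terms-Deriv xs≈ys)) (symm (bound-rename h b c _ c≢b c#ys))) }
    ; op₀-equiv = λ f m _ π xs →
        Deriv-reflexive (cong (pure f) (terms-act π xs)) (pure f (actTs-UD sig aX π (proj₂ (unzipT xs))))
    ; opf-equiv = λ g m _ π a xs →
        Deriv-reflexive (cong (free g (fun π a)) (terms-act π xs))
                        (free g (fun π a) (actTs-UD sig aX π (proj₂ (unzipT xs))))
    ; opb-equiv = λ h m _ π a xs →
        Deriv-reflexive (cong (bound h (fun π a)) (terms-act π xs))
                        (bound h (fun π a) (actTs-UD sig aX π (proj₂ (unzipT xs))))
    }

module TermAlgebraModel (T : Theory) (n : ℕ∞) (X : NomType) where
  open Theory T
  open Signature sig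
  open TermAlgebra T n X
  open TermAction sig X
  open Derivations T X
  open TermAlgebraLaws T n X
  private
    F = FX laws

  proj₁-cast : ∀ {i j} (e : i ≡ j) (t : FCar i) → proj₁ (subst FCar e t) ≡ proj₁ t
  proj₁-cast refl t = refl

  module _ {V : Set} {k : ℕ} (ι : V → FCar k) where
    open Eval F ι

    mutual
      eval-FX : ∀ {m} t (p : UD sig m t) .q → proj₁ (eval t p q) ≡ substT sig (proj₁ ∘ ι) t
      eval-FX (var x) (var .x) q = proj₁-cast (sym (+-identityʳ k)) (ι x)
      eval-FX (pure f ts) (pure {m} .f ps) q =
        trans (proj₁-cast (+-assoc k m (d₀ f)) _) (cong (pure f) (evals-FX ts ps _))
      eval-FX (free g a ts) (free {m} .g .a ps) q =
        trans (proj₁-cast (+-assoc k m (df g)) _) (cong (free g a) (evals-FX ts ps _))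
      eval-FX (bound h a ts) (bound {m} .h .a ps) q =
        trans (proj₁-cast (+-assoc k m (db h)) _) (cong (bound h a) (evals-FX ts ps _))

      evals-FX : ∀ {m p} (ts : Vec (Term sig V) p) (ps : All (UD sig m) ts) .q →
                 terms (evals ts ps q) ≡ substTs sig (proj₁ ∘ ι) ts
      evals-FX [] [] q = refl
      evals-FX (t ∷ ts) (p ∷ ps) q = cong₂ _∷_ (eval-FX t p q) (evals-FX ts ps q)

  -- Each equation is derivable by (ax) with τ = id and σ = proj₁ ∘ ι.
  FX-model : IsModel T F
  FX-model e k q ι ι-equiv =
    Deriv-≡ (eval-FX ι (lhs e) (lhs-UD e) q) (eval-FX ι (rhs e) (rhs-UD e) q)
      (subst (λ j → Deriv T X j (substT sig σ (lhs e)) (substT sig σ (rhs e))) (+-comm (depth e) k)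
        (Deriv-≡ (cong (substT sig σ) (sym (TermAction.aT-id sig (ctx e) (lhs e))))
                 (cong (substT sig σ) (sym (TermAction.aT-id sig (ctx e) (rhs e))))
                 (ax e idP σ (λ y → proj₂ (ι y)) (λ π y → symm (ι-equiv π y)))))
    where
      σ = proj₁ ∘ ι

module AlgebraProperties {Sg : Signature} {n : ℕ∞} (A : Algebra Sg n) where
  open Signature Sg
  open Algebra A
  private
    module Lvl (i : ℕ) = NomSetoidProperties (NomSetoid.isNomSetoid (Car i))

  ≈-refl : ∀ {i x} → Eq i x x
  ≈-refl {i} = Lvl.≈-refl i

  ≈-sym : ∀ {i x y} → Eq i x y → Eq i y x
  ≈-sym {i} = Lvl.≈-sym i

  ≈-trans : ∀ {i x y z} → Eq i x y → Eq i y z → Eq i x z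
  ≈-trans {i} = Lvl.≈-trans i

  ≈-reflexive : ∀ {i x y} → x ≡ y → Eq i x y
  ≈-reflexive {i} = Lvl.≈-reflexive i

  actA-cong : ∀ {i} π {x y} → Eq i x y → Eq i (actA i π x) (actA i π y)
  actA-cong {i} = Lvl.act-cong i

  cast-≈ : ∀ {i j} (e : i ≡ j) {x y} → Eq i x y → Eq j (subst C e x) (subst C e y)
  cast-≈ refl x≈y = x≈y

  cast-equivariant : ∀ {i j} (e : i ≡ j) π {x y} → Eq i x (actA i π y) →
                     Eq j (subst C e x) (actA j π (subst C e y))
  cast-equivariant refl π x≈πy = x≈πy

  opb-congʳ : ∀ h m .p a {xs ys} → Pointwise (Eq m) xs ys → Eq (m + db h) (opb h m p a xs) (opb h m p a ys)
  opb-congʳ h m p a xs≈ys = opb-cong h m p a a (AlphaEquivalence.alphaEq-cong (Car m) a xs≈ys)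

  ≤̂-assoc : ∀ k m d → k + (m + d) ≤̂ n → (k + m) + d ≤̂ n
  ≤̂-assoc k m d = subst (_≤̂ n) (sym (+-assoc k m d))

  ≤̂-args : ∀ k m d → k + (m + d) ≤̂ n → k + m ≤̂ n
  ≤̂-args k m d q = ≤̂-weaken d n (≤̂-assoc k m d q)

  module EvalEquivariance (Z : NomType) {k : ℕ} (ι : NomType.Car Z → C k)
                          (ι-equiv : ∀ π y → Eq k (ι (NomType.act Z π y)) (actA k π (ι y))) where
    open Eval A ι
    private
      actZ = NomType.act Z

    mutual
      eval-equivariant : ∀ {m} t (p : UD Sg m t) .q π →
                         Eq (k + m) (eval (actT Sg actZ π t) (actT-UD Sg actZ π p) q) (actA (k + m) π (eval t p q))
      eval-equivariant (var x) (var .x) q π = cast-equivariant (sym (+-identityʳ k)) π (ι-equiv π x)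
      eval-equivariant (pure f ts) (pure {m} .f ps) q π =
        cast-equivariant (+-assoc k m (d₀ f)) π
          (≈-trans (op₀-cong f (k + m) (≤̂-assoc k m (d₀ f) q) (evals-equivariant ts ps (≤̂-args k m (d₀ f) q) π))
                   (op₀-equiv f (k + m) (≤̂-assoc k m (d₀ f) q) π _))
      eval-equivariant (free g a ts) (free {m} .g .a ps) q π =
        cast-equivariant (+-assoc k m (df g)) π
          (≈-trans (opf-cong g (k + m) (≤̂-assoc k m (df g) q) (fun π a) (evals-equivariant ts ps (≤̂-args k m (df g) q) π))
                   (opf-equiv g (k + m) (≤̂-assoc k m (df g) q) π a _))
      eval-equivariant (bound h a ts) (bound {m} .h .a ps) q π =
        cast-equivariant (+-assoc k m (db h)) π
          (≈-trans (opb-congʳ h (k + m) (≤̂-assoc k m (db h) q) (fun π a) (evals-equivariant ts ps (≤̂-args k m (db h) q) π))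
                   (opb-equiv h (k + m) (≤̂-assoc k m (db h) q) π a _))

      evals-equivariant : ∀ {m p} (ts : Vec (Term Sg _) p) (ps : All (UD Sg m) ts) .q π →
                          Pointwise (Eq (k + m)) (evals (actTs Sg actZ π ts) (actTs-UD Sg actZ π ps) q)
                                                 (actV (actA (k + m)) π (evals ts ps q))
      evals-equivariant [] [] q π = []
      evals-equivariant (t ∷ ts) (p ∷ ps) q π = eval-equivariant t p q π ∷ evals-equivariant ts ps q π

module Freeness (T : Theory) (n : ℕ∞) (X : NomType)
                (A : Algebra (Theory.sig T) n) (A-model : IsModel T A)
                (g : NomType.Car X → Algebra.C A 0)
                (g-equiv : ∀ π x → Algebra.Eq A 0 (g (NomType.act X π x)) (Algebra.actA A 0 π (g x))) where
  open Theory T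
  open Signature sig
  open Algebra A
  open AlgebraProperties A
  open TermAlgebra T n X
  open TermAction sig X
  open Derivations T X
  open TermAlgebraLaws T n X
  open Eval A g using (eval; evals)
  open EvalEquivariance X g g-equiv
  private
    D = Deriv T X
    aX = NomType.act X

  GradedOp : ℕ → ℕ → Set
  GradedOp d p = ∀ m → .(m + d ≤̂ n) → Vec (C m) p → C (m + d)

  -- A term may have uniform depth at several indices (e.g. a constant), so
  -- evaluations under different depth proofs are compared across a cast.
  mutual
    eval-irrelevant : ∀ t {j j′} (p : UD sig j t) (p′ : UD sig j′ t) (e : j ≡ j′) .q .q′ →
                      eval t p′ q′ ≡ subst C e (eval t p q)
    eval-irrelevant (var x) (var .x) (var .x) refl q q′ = refl
    eval-irrelevant (pure f ts) (pure .f ps) (pure .f ps′) e q q′ =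
      op-irrelevant (op₀ f) ps ps′ e q q′
    eval-irrelevant (free f a ts) (free .f .a ps) (free .f .a ps′) e q q′ =
      op-irrelevant (λ m q → opf f m q a) ps ps′ e q q′
    eval-irrelevant (bound f a ts) (bound .f .a ps) (bound .f .a ps′) e q q′ =
      op-irrelevant (λ m q → opb f m q a) ps ps′ e q q′

    op-irrelevant : ∀ {d p} (op : GradedOp d p) {m m′} {ts : Vec Tm p}
                    (ps : All (UD sig m) ts) (ps′ : All (UD sig m′) ts) (e : m + d ≡ m′ + d) .q .q′ →
                    op m′ q′ (evals ts ps′ (≤̂-weaken d n q′)) ≡ subst C e (op m q (evals ts ps (≤̂-weaken d n q)))
    op-irrelevant {d} op {m} {m′} ps ps′ e q q′ with +-cancelʳ-≡ d m m′ e | e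
    ... | refl | refl = cong (op m q) (evals-irrelevant _ ps ps′ _ _)

    evals-irrelevant : ∀ {m p} (ts : Vec Tm p) (ps ps′ : All (UD sig m) ts) .q .q′ → evals ts ps′ q′ ≡ evals ts ps q
    evals-irrelevant [] [] [] q q′ = refl
    evals-irrelevant (t ∷ ts) (p ∷ ps) (p′ ∷ ps′) q q′ =
      cong₂ _∷_ (eval-irrelevant t p p′ refl q q′) (evals-irrelevant ts ps ps′ q q′)

  eval-≡ : ∀ {m t t′} → t ≡ t′ → ∀ (p : UD sig m t) (p′ : UD sig m t′) .q → eval t p q ≡ eval t′ p′ q
  eval-≡ refl p p′ q = sym (eval-irrelevant _ p p′ refl q q)

  module Substitution {Y : Set} (σ : Y → Tm) (l : ℕ) (κ : Y → C l)
                      (σ-κ : ∀ y {j} (p : UD sig j (σ y)) (e : l ≡ j) .q → eval (σ y) p q ≡ subst C e (κ y)) where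
    open Eval A κ renaming (eval to evalκ; evals to evalsκ)

    private
      subst-cancel : ∀ {i j} (e : i ≡ j) (e′ : j ≡ i) (x : C i) → subst C e′ (subst C e x) ≡ x
      subst-cancel refl refl x = refl

    mutual
      eval-substT : ∀ {m} r (ur : UD sig m r) {j} (p : UD sig j (substT sig σ r)) (e : l + m ≡ j) .q .q′ →
                    eval (substT sig σ r) p q ≡ subst C e (evalκ r ur q′)
      eval-substT (var y) (var .y) p e q q′ =
        trans (σ-κ y p (trans (sym (+-identityʳ l)) e) q) (sym (≡.subst-subst (sym (+-identityʳ l))))
      eval-substT (pure f rs) (pure .f urs) (pure .f ps) e q q′ =
        op-substT (op₀ f) urs ps e q q′
      eval-substT (free f a rs) (free .f .a urs) (free .f .a ps) e q q′ =
        op-substT (λ m q → opf f m q a) urs ps e q q′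
      eval-substT (bound f a rs) (bound .f .a urs) (bound .f .a ps) e q q′ =
        op-substT (λ m q → opb f m q a) urs ps e q q′

      op-substT : ∀ {d p} (op : GradedOp d p) {m m′} {rs : Vec (Term sig Y) p}
                  (urs : All (UD sig m) rs) (ps : All (UD sig m′) (substTs sig σ rs))
                  (e : l + (m + d) ≡ m′ + d) .q .q′ →
                  op m′ q (evals (substTs sig σ rs) ps (≤̂-weaken d n q))
                  ≡ subst C e (subst C (+-assoc l m d)
                                (op (l + m) (≤̂-assoc l m d q′) (evalsκ rs urs (≤̂-args l m d q′))))
      op-substT {d} op {m} {m′} urs ps e q q′ with +-cancelʳ-≡ d (l + m) m′ (trans (+-assoc l m d) e)
      ... | refl = trans (cong (op (l + m) q) (evals-substT _ urs ps _ _)) (sym (subst-cancel (+-assoc l m d) e _))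

      evals-substT : ∀ {m p} (rs : Vec (Term sig Y) p) (urs : All (UD sig m) rs)
                     (ps : All (UD sig (l + m)) (substTs sig σ rs)) .q .q′ →
                     evals (substTs sig σ rs) ps q ≡ evalsκ rs urs q′
      evals-substT [] [] [] q q′ = refl
      evals-substT (r ∷ rs) (ur ∷ urs) (p ∷ ps) q q′ =
        cong₂ _∷_ (eval-substT r ur p refl q q′) (evals-substT rs urs ps q q′)

  eval-fresh : ∀ {a m t} (p : UD sig m t) .q → FreshT T X a t → Fresh (Eq m) (actA m) a (eval t p q)
  eval-fresh {t = t} p q (S , a∉S , sup) =
    S , a∉S , λ π fx → ≈-trans (≈-sym (eval-equivariant t p q π)) (≈-reflexive (eval-≡ (sup π fx) _ p q))

  evals-fresh : ∀ {a m p} {us : Vec Tm p} → All (FreshT T X a) us → ∀ (ps : All (UD sig m) us) .q →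
                All (Fresh (Eq m) (actA m) a) (evals us ps q)
  evals-fresh [] [] q = []
  evals-fresh (a#u ∷ a#us) (p ∷ ps) q = eval-fresh p q a#u ∷ evals-fresh a#us ps q

  sound-ax : ∀ e τ {l} (σ : NomType.Car (ctx e) → Tm) (σ-UD : ∀ y → UD sig l (σ y)) →
             (∀ π y (p : UD sig l (aT π (σ y))) (p′ : UD sig l (σ (NomType.act (ctx e) π y))) .(q : l ≤̂ n) →
                Eq l (eval _ p q) (eval _ p′ q)) →
             (pl : UD sig (depth e + l) (substT sig σ (actT sig (NomType.act (ctx e)) τ (lhs e))))
             (pr : UD sig (depth e + l) (substT sig σ (actT sig (NomType.act (ctx e)) τ (rhs e))))
             .(q : depth e + l ≤̂ n) → Eq (depth e + l) (eval _ pl q) (eval _ pr q)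
  sound-ax e τ {l} σ σ-UD side-sound pl pr q =
    ≈-trans (≈-reflexive (eval-instance (lhs e) (lhs-UD e) pl))
            (≈-trans (cast-≈ l+de≡de+l τ·axiom) (≈-reflexive (sym (eval-instance (rhs e) (rhs-UD e) pr))))
    where
      de = depth e
      actY = NomType.act (ctx e)
      l+de≡de+l = +-comm l de
      q! = ≤̂-recompute n q
      q′ : l + de ≤̂ n
      q′ = subst (_≤̂ n) (sym l+de≡de+l) q!
      ql : l ≤̂ n
      ql = ≤̂-mono n (m≤n+m l de) q!

      κ : NomType.Car (ctx e) → C l
      κ y = eval (σ y) (σ-UD y) ql

      κ-equiv : ∀ π y → Eq l (κ (actY π y)) (actA l π (κ y))
      κ-equiv π y = ≈-trans (≈-sym (side-sound π y (actT-UD sig aX π (σ-UD y)) (σ-UD _) ql))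
                            (eval-equivariant (σ y) (σ-UD y) ql π)

      open Substitution σ l κ (λ y p e′ q → eval-irrelevant (σ y) (σ-UD y) p e′ ql q)
      open Eval A κ renaming (eval to evalκ)
      module E = EvalEquivariance (ctx e) κ κ-equiv

      evalκ-τ : ∀ r → UD sig de r → C (l + de)
      evalκ-τ r p = evalκ (actT sig actY τ r) (actT-UD sig actY τ p) q′

      τ·axiom : Eq (l + de) (evalκ-τ (lhs e) (lhs-UD e)) (evalκ-τ (rhs e) (rhs-UD e))
      τ·axiom = ≈-trans (E.eval-equivariant (lhs e) (lhs-UD e) q′ τ)
                  (≈-trans (actA-cong τ (A-model e l q′ κ κ-equiv))
                           (≈-sym (E.eval-equivariant (rhs e) (rhs-UD e) q′ τ)))

      eval-instance : ∀ r (ur : UD sig de r) p →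
                      eval (substT sig σ (actT sig actY τ r)) p q ≡ subst C l+de≡de+l (evalκ-τ r ur)
      eval-instance r ur p = eval-substT (actT sig actY τ r) (actT-UD sig actY τ ur) p l+de≡de+l q q′

  mutual
    sound : ∀ {i t u} (d : D i t u) .(q : i ≤̂ n) →
            Eq i (eval t (proj₁ (Deriv-UD d)) q) (eval u (proj₂ (Deriv-UD d)) q)
    sound (refl′ x) q = ≈-refl
    sound (symm d) q = ≈-sym (sound d q)
    sound (trans′ {u = u} d d′) q =
      ≈-trans (sound d q)
        (≈-trans (≈-reflexive (eval-irrelevant u (proj₁ (Deriv-UD d′)) (proj₂ (Deriv-UD d)) refl q q)) (sound d′ q))
    sound (cong₀ {m} f ds) q = op₀-cong f m q (sounds ds (≤̂-weaken (d₀ f) n q))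
    sound (congf {m} f a ds) q = opf-cong f m q a (sounds ds (≤̂-weaken (df f) n q))
    sound (congb {m} f a ds) q = opb-congʳ f m q a (sounds ds (≤̂-weaken (db f) n q))
    sound (ax e τ σ σ-UD side) q = sound-ax e τ σ σ-UD (λ π y → sound′ (side π y)) _ _ q
    sound (perm {m} f a b _ a#us ds) q =
      ≈-trans (opb-congʳ f m q a (sounds-swap a b ds _ _ (≤̂-weaken (db f) n q)))
              (opb-cong f m q a b
                 (AlphaEquivalence.alphaEq-swap (Car m) a b _
                    (VecNomSetoid.fresh-all (NomSetoid.isNomSetoid (Car m))
                       (evals-fresh a#us (proj₂ (Deriv-UDs-swap a b ds)) (≤̂-weaken (db f) n q)))))

    sound′ : ∀ {i t u} → D i t u → (pt : UD sig i t) (pu : UD sig i u) .(q : i ≤̂ n) →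
             Eq i (eval t pt q) (eval u pu q)
    sound′ {t = t} {u} d pt pu q =
      ≈-trans (≈-reflexive (eval-irrelevant t (proj₁ (Deriv-UD d)) pt refl q q))
              (≈-trans (sound d q) (≈-reflexive (eval-irrelevant u pu (proj₂ (Deriv-UD d)) refl q q)))

    sounds : ∀ {m p} {ts us : Vec Tm p} (ds : Pointwise (D m) ts us) .q →
             Pointwise (Eq m) (evals ts (proj₁ (Deriv-UDs ds)) q) (evals us (proj₂ (Deriv-UDs ds)) q)
    sounds [] q = []
    sounds (d ∷ ds) q = sound d q ∷ sounds ds q

    sounds-swap : ∀ {m p} a b {ts us : Vec Tm p} → Pointwise (λ t u → D m t (aT (swap a b) u)) ts us →
                  ∀ (ps : All (UD sig m) ts) (pus : All (UD sig m) us) .q →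
                  Pointwise (Eq m) (evals ts ps q) (actV (actA m) (swap a b) (evals us pus q))
    sounds-swap a b [] [] [] q = []
    sounds-swap a b (d ∷ ds) (p ∷ ps) (pu ∷ pus) q =
      ≈-trans (sound′ d p (actT-UD sig aX (swap a b) pu) q) (eval-equivariant _ pu q (swap a b))
      ∷ sounds-swap a b ds ps pus q

  evals-terms : ∀ {m p} (xs : Vec (FCar m) p) .q →
                evals (terms xs) (proj₂ (unzipT xs)) q ≡ map (λ t → eval (proj₁ t) (proj₂ t) q) xs
  evals-terms [] q = refl
  evals-terms (x ∷ xs) q = cong (_ ∷_) (evals-terms xs q)

  evalHom : Hom (FX laws) A
  evalHom = record
    { hom = λ i q t → eval (proj₁ t) (proj₂ t) q
    ; hom-cong = λ i q {t} {u} d → sound′ d (proj₂ t) (proj₂ u) q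
    ; hom-equiv = λ i q π t → eval-equivariant (proj₁ t) (proj₂ t) q π
    ; hom-op₀ = λ f m q xs → ≈-reflexive (cong (op₀ f m q) (evals-terms xs _))
    ; hom-opf = λ f m q a xs → ≈-reflexive (cong (opf f m q a) (evals-terms xs _))
    ; hom-opb = λ f m q a xs → ≈-reflexive (cong (opb f m q a) (evals-terms xs _))
    }

  zipT : ∀ {m p} (ts : Vec Tm p) → All (UD sig m) ts → Vec (FCar m) p
  zipT [] [] = []
  zipT (t ∷ ts) (p ∷ ps) = (t , p) ∷ zipT ts ps

  terms-zipT : ∀ {m p} (ts : Vec Tm p) (ps : All (UD sig m) ts) → terms (zipT ts ps) ≡ ts
  terms-zipT [] [] = refl
  terms-zipT (t ∷ ts) (p ∷ ps) = cong (t ∷_) (terms-zipT ts ps)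

  module _ (h : Hom (FX laws) A) (h-η : ∀ x → Eq 0 (Hom.hom h 0 (0≤̂ n) (η x)) (g x)) where
    open Hom h using (hom; hom-cong; hom-op₀; hom-opf; hom-opb)

    mutual
      hom≈eval : ∀ {i} t (p : UD sig i t) .q → Eq i (hom i q (t , p)) (eval t p q)
      hom≈eval (var x) (var .x) q = h-η x
      hom≈eval (pure f ts) (pure {m} .f ps) q =
        ≈-trans (hom-cong _ q (Deriv-≡ refl (cong (pure f) (terms-zipT ts ps)) (Deriv-refl (pure f ps))))
                (≈-trans (hom-op₀ f m q (zipT ts ps)) (op₀-cong f m q (homs≈evals ts ps _)))
      hom≈eval (free f a ts) (free {m} .f .a ps) q =
        ≈-trans (hom-cong _ q (Deriv-≡ refl (cong (free f a) (terms-zipT ts ps)) (Deriv-refl (free f a ps))))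
                (≈-trans (hom-opf f m q a (zipT ts ps)) (opf-cong f m q a (homs≈evals ts ps _)))
      hom≈eval (bound f a ts) (bound {m} .f .a ps) q =
        ≈-trans (hom-cong _ q (Deriv-≡ refl (cong (bound f a) (terms-zipT ts ps)) (Deriv-refl (bound f a ps))))
                (≈-trans (hom-opb f m q a (zipT ts ps)) (opb-congʳ f m q a (homs≈evals ts ps _)))

      homs≈evals : ∀ {m p} (ts : Vec Tm p) (ps : All (UD sig m) ts) .q →
                   Pointwise (Eq m) (map (hom m q) (zipT ts ps)) (evals ts ps q)
      homs≈evals [] [] q = []
      homs≈evals (t ∷ ts) (p ∷ ps) q = hom≈eval t p q ∷ homs≈evals ts ps q

    evalHom-unique : ∀ i .q t → Eq i (hom i q t) (Hom.hom evalHom i q t)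
    evalHom-unique i q (t , p) = hom≈eval t p q

theorem2 : (T : Theory) (n : ℕ∞) (X : NomType) →
    Σ (TermAlgebra.Laws T n X) λ L →
      IsModel T (TermAlgebra.FX T n X L) ×
      IsFree T X (TermAlgebra.FX T n X L) (TermAlgebra.η T n X)
theorem2 T n X =
  TermAlgebraLaws.laws T n X , TermAlgebraModel.FX-model T n X ,
  λ A A-model g g-equiv →
    let open Freeness T n X A A-model g g-equiv
    in evalHom , (λ x → AlgebraProperties.≈-refl A) , evalHom-unique
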